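{- Let $G$ be a graph, $M$ a modulator of $G$, and $C$ a connected component of $G-M$ that is a complete multipartite graph. Then each part of $C$ is a false twin class of $G$.
   Context: All graphs are finite, simple and undirected. A paw is the four-vertex graph consisting of a triangle together with one additional vertex adjacent to exactly one vertex of the triangle. A set $M\subseteq V(G)$ is a modulator of $G$ if every vertex set $F\subseteq V(G)$ inducing a paw in $G$ satisfies $|F\cap M|\ge 2$. A complete multipartite graph is a graph whose vertex set can be partitioned into $p\ge 3$ independent sets (parts) with every pair of vertices from different parts adjacent. A false twin class of $G$ is a set of vertices all of which have the same open neighborhood $N(\cdot)$ in $G$. -}

module Defs where

open import Data.Nat using (ℕ; _≥_)
open import Data.Fin using (Fin)
open import Data.Fin.Subset using (Subset; _∈_; _∉_; _∩_; _∪_; ⁅_⁆; ∣_∣)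
open import Data.Bool using (Bool; true; false)
open import Data.Product using (Σ; ∃; _×_; _,_)
open import Relation.Binary.PropositionalEquality using (_≡_; _≢_)

record Graph : Set where
  field
    n     : ℕ
    adj   : Fin n → Fin n → Bool
    sym   : ∀ u v → adj u v ≡ adj v u
    irrfl : ∀ v → adj v v ≡ false

open Graph public

-- F induces a paw: F = {a,b,c,d}, abc a triangle, d adjacent to a only
-- (among b, c).  Distinctness of a,b,c,d follows from the adjacencies.
InducesPaw : (G : Graph) → Subset (n G) → Set
InducesPaw G F =
  Σ (Fin (n G)) λ a → Σ (Fin (n G)) λ b → Σ (Fin (n G)) λ c → Σ (Fin (n G)) λ d →
    (F ≡ ((⁅ a ⁆ ∪ ⁅ b ⁆) ∪ (⁅ c ⁆ ∪ ⁅ d ⁆)))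
    × adj G a b ≡ true × adj G b c ≡ true × adj G a c ≡ true
    × adj G a d ≡ true × adj G b d ≡ false × adj G c d ≡ false

IsModulator : (G : Graph) → Subset (n G) → Set
IsModulator G M = ∀ (F : Subset (n G)) → InducesPaw G F → ∣ F ∩ M ∣ ≥ 2

data ReachIn (G : Graph) (C : Subset (n G)) : Fin (n G) → Fin (n G) → Set where
  here : ∀ {u} → u ∈ C → ReachIn G C u u
  step : ∀ {u v w} → ReachIn G C u v → w ∈ C → adj G v w ≡ true → ReachIn G C u w

IsComponentOfMinus : (G : Graph) → Subset (n G) → Subset (n G) → Set
IsComponentOfMinus G M C =
  (∀ v → v ∈ C → v ∉ M)
  × (∃ λ v → v ∈ C)
  × (∀ u v → u ∈ C → v ∈ C → ReachIn G C u v)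
  × (∀ u v → u ∈ C → v ∉ M → adj G u v ≡ true → v ∈ C)

-- G[C] is complete multipartite with p parts given by the labelling f:
-- part i = { v ∈ C | f v ≡ i }.
IsCompleteMultipartiteBy : (G : Graph) (C : Subset (n G)) (p : ℕ) → (Fin (n G) → Fin p) → Set
IsCompleteMultipartiteBy G C p f =
  p ≥ 3
  × (∀ (i : Fin p) → ∃ λ v → v ∈ C × f v ≡ i)
  × (∀ u v → u ∈ C → v ∈ C → f u ≡ f v → adj G u v ≡ false)
  × (∀ u v → u ∈ C → v ∈ C → f u ≢ f v → adj G u v ≡ true)

IsFalseTwinClass : (G : Graph) → (Fin (n G) → Set) → Set
IsFalseTwinClass G P = ∀ u v → P u → P v → ∀ w → adj G u w ≡ adj G v w

-- Let x, y lie in one part of C and let w be adjacent to x but not to y.  Choose s, t in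
-- two further parts; x, s, t form a triangle outside M.  If s (or t) were adjacent to w,
-- it would form with x, w, y a paw meeting M only in w; otherwise x, s, t, w is such a paw.
-- Nothing is assumed about w.
module Submission where

open import Defs hiding (sym)
open import Data.Nat using (ℕ; _≤_; s≤s)
open import Data.Nat.Properties using (≤-trans)
open import Data.Fin using (Fin; zero; suc; punchIn)
open import Data.Fin.Properties using (punchInᵢ≢i; punchIn-injective)
open import Data.Fin.Subset using (Subset; _∈_; _∉_; _⊆_; _∩_; _∪_; ⁅_⁆; ∣_∣)
open import Data.Fin.Subset.Properties using (x∈⁅x⁆; x∈⁅y⁆⇒x≡y; ∣⁅x⁆∣≡1; p⊆q⇒∣p∣≤∣q∣; x∈p∩q⁻; x∈p∪q⁻)
open import Data.Bool using (Bool; true; false)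
open import Data.Bool.Properties using (⇔→≡)
open import Data.Product using (_×_; _,_; ∃₂)
open import Data.Sum using (_⊎_; inj₁; inj₂; [_,_])
import Data.Sum as Sum
open import Data.Empty using (⊥; ⊥-elim)
open import Function using (_∘_)
open import Function.Bundles using (mk⇔)
open import Relation.Binary.PropositionalEquality using (_≡_; _≢_; refl; sym; trans; subst)

two-others : ∀ {p} → 3 ≤ p → (i : Fin p) → ∃₂ λ j k → j ≢ i × k ≢ i × j ≢ k
two-others (s≤s (s≤s (s≤s _))) i =
  punchIn i zero , punchIn i (suc zero) ,
  punchInᵢ≢i i zero , punchInᵢ≢i i (suc zero) , (λ ()) ∘ punchIn-injective i zero (suc zero)

pawSet : ∀ {m} → Fin m → Fin m → Fin m → Fin m → Subset m
pawSet a b c d = (⁅ a ⁆ ∪ ⁅ b ⁆) ∪ (⁅ c ⁆ ∪ ⁅ d ⁆)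

∈-pawSet⁻ : ∀ {m} {a b c d z : Fin m} → z ∈ pawSet a b c d → (z ≡ a ⊎ z ≡ b) ⊎ (z ≡ c ⊎ z ≡ d)
∈-pawSet⁻ {a = a} {b} {c} {d} =
  Sum.map (Sum.map (x∈⁅y⁆⇒x≡y a) (x∈⁅y⁆⇒x≡y b) ∘ x∈p∪q⁻ ⁅ a ⁆ ⁅ b ⁆)
          (Sum.map (x∈⁅y⁆⇒x≡y c) (x∈⁅y⁆⇒x≡y d) ∘ x∈p∪q⁻ ⁅ c ⁆ ⁅ d ⁆)
  ∘ x∈p∪q⁻ (⁅ a ⁆ ∪ ⁅ b ⁆) (⁅ c ⁆ ∪ ⁅ d ⁆)

Paw : (G : Graph) → (a b c d : Fin (n G)) → Set
Paw G a b c d =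
  adj G a b ≡ true × adj G b c ≡ true × adj G a c ≡ true
  × adj G a d ≡ true × adj G b d ≡ false × adj G c d ≡ false

adj-sym : ∀ (G : Graph) {x y : Fin (n G)} {b : Bool} → adj G x y ≡ b → adj G y x ≡ b
adj-sym G {x} {y} = trans (Graph.sym G y x)

module _ {G : Graph} {M : Subset (n G)} (modulator : IsModulator G M) where

  ¬paw-meeting-modulator-only-in : ∀ w {a b c d} → Paw G a b c d →
    (a ∈ M → a ≡ w) → (b ∈ M → b ≡ w) → (c ∈ M → c ≡ w) → (d ∈ M → d ≡ w) → ⊥
  ¬paw-meeting-modulator-only-in w {a} {b} {c} {d} paw aw bw cw dw
    with ≤-trans (modulator F (a , b , c , d , refl , paw)) ∣F∩M∣≤1
    where
    F : Subset (n G)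
    F = pawSet a b c d

    F∩M⊆⁅w⁆ : F ∩ M ⊆ ⁅ w ⁆
    F∩M⊆⁅w⁆ {z} z∈F∩M with x∈p∩q⁻ F M z∈F∩M
    ... | z∈F , z∈M = subst (_∈ ⁅ w ⁆) (sym (onlyW (∈-pawSet⁻ z∈F))) (x∈⁅x⁆ w)
      where
      onlyW : (z ≡ a ⊎ z ≡ b) ⊎ (z ≡ c ⊎ z ≡ d) → z ≡ w
      onlyW = [ [ (λ { refl → aw z∈M }) , (λ { refl → bw z∈M }) ]
              , [ (λ { refl → cw z∈M }) , (λ { refl → dw z∈M }) ] ]

    ∣F∩M∣≤1 : ∣ F ∩ M ∣ ≤ 1
    ∣F∩M∣≤1 = subst (∣ F ∩ M ∣ ≤_) (∣⁅x⁆∣≡1 w) (p⊆q⇒∣p∣≤∣q∣ F∩M⊆⁅w⁆)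
  ... | s≤s ()

  module _ {x y z w : Fin (n G)} (x∉M : x ∉ M) (y∉M : y ∉ M) (z∉M : z ∉ M) where

    common-neighbour-not-adjacent : adj G x y ≡ false → adj G z x ≡ true → adj G z y ≡ true →
      adj G x w ≡ true → adj G y w ≡ false → adj G z w ≡ false
    common-neighbour-not-adjacent xy zx zy xw yw with adj G z w in zw
    ... | false = refl
    ... | true = ⊥-elim (¬paw-meeting-modulator-only-in w
                  (zx , xw , zw , zy , xy , adj-sym G yw)
                  (⊥-elim ∘ z∉M) (⊥-elim ∘ x∉M) (λ _ → refl) (⊥-elim ∘ y∉M))

    triangle-neighbour-sees-another-corner : adj G x y ≡ true → adj G y z ≡ true → adj G x z ≡ true →
      adj G x w ≡ true → adj G y w ≡ true ⊎ adj G z w ≡ true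
    triangle-neighbour-sees-another-corner xy yz xz xw with adj G y w in yw | adj G z w in zw
    ... | true  | _     = inj₁ refl
    ... | false | true  = inj₂ refl
    ... | false | false = ⊥-elim (¬paw-meeting-modulator-only-in w
                            (xy , yz , xz , xw , yw , zw)
                            (⊥-elim ∘ x∉M) (⊥-elim ∘ y∉M) (⊥-elim ∘ z∉M) (λ _ → refl))

  module _ {C : Subset (n G)} {p : ℕ} {f : Fin (n G) → Fin p} (C-avoids-M : ∀ v → v ∈ C → v ∉ M) where

    part-neighbour-shared : IsCompleteMultipartiteBy G C p f →
      ∀ {x y w} → x ∈ C → y ∈ C → f x ≡ f y → adj G x w ≡ true → adj G y w ≡ true
    part-neighbour-shared (p≥3 , nonempty , independent , complete) {x} {y} {w} xC yC fx≡fy xw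
      with adj G y w in yw
    ... | true = refl
    ... | false with two-others p≥3 (f x)
    ...   | j , k , j≢fx , k≢fx , j≢k with nonempty j | nonempty k
    ...     | s , sC , fs≡j | t , tC , ft≡k =
      ⊥-elim ([ clash (misses s sC fx≢fs) , clash (misses t tC fx≢ft) ]
        (triangle-neighbour-sees-another-corner (C-avoids-M x xC) (C-avoids-M s sC) (C-avoids-M t tC)
          (complete x s xC sC fx≢fs) (complete s t sC tC fs≢ft) (complete x t xC tC fx≢ft) xw))
      where
      fx≢fs : f x ≢ f s
      fx≢fs e = j≢fx (trans (sym fs≡j) (sym e))

      fx≢ft : f x ≢ f t
      fx≢ft e = k≢fx (trans (sym ft≡k) (sym e))

      fs≢ft : f s ≢ f t
      fs≢ft e = j≢k (trans (sym fs≡j) (trans e ft≡k))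

      clash : ∀ {b} → b ≡ false → b ≡ true → ⊥
      clash refl ()

      misses : ∀ z → z ∈ C → f x ≢ f z → adj G z w ≡ false
      misses z zC fx≢fz =
        common-neighbour-not-adjacent (C-avoids-M x xC) (C-avoids-M y yC) (C-avoids-M z zC)
          (independent x y xC yC fx≡fy)
          (adj-sym G (complete x z xC zC fx≢fz))
          (adj-sym G (complete y z yC zC (fx≢fz ∘ trans fx≡fy)))
          xw yw

    parts-are-false-twin-classes : IsCompleteMultipartiteBy G C p f →
      (i : Fin p) → IsFalseTwinClass G (λ v → v ∈ C × f v ≡ i)
    parts-are-false-twin-classes multipartite i u v (uC , fu≡i) (vC , fv≡i) w =
      ⇔→≡ (mk⇔ (part-neighbour-shared multipartite uC vC (trans fu≡i (sym fv≡i)))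
                (part-neighbour-shared multipartite vC uC (trans fv≡i (sym fu≡i))))

corollary8 : (G : Graph) (M C : Subset (n G)) → IsModulator G M → IsComponentOfMinus G M C →
    (p : ℕ) (f : Fin (n G) → Fin p) → IsCompleteMultipartiteBy G C p f →
    (i : Fin p) → IsFalseTwinClass G (λ v → v ∈ C × f v ≡ i)
corollary8 G M C modulator (C-avoids-M , _) p f = parts-are-false-twin-classes {G} modulator C-avoids-M
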